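{- Let $P:\beta^0\subset\beta^1\subset\cdots\subset\beta^k$ be a standard tableau (each $\beta^{i}/\beta^{i-1}$ a single box) where each $\beta^i$ is written with $n$ nonnegative parts, let $b$ be the first (largest) part of $\beta^k$, and write $\beta^0=(b_1\geq\cdots\geq b_n\geq 0)$. Regard each $\beta^i$ as the stable shape $(\infty,\beta^i_1,\dots,\beta^i_n,0)$, and let $\gamma^0$ be the stable shape $(b,b_1,\dots,b_n,\bar\infty)$; then $Q:=\beta^0/\gamma^0$ is a stable horizontal strip extended by $P$. Let $(T;U)=\mathcal{H}(P;Q)$ and write $T$ as $\gamma^0\subset\gamma^1\subset\cdots\subset\gamma^k$. Let $\mathcal{S}(P)=\alpha^0\subset\cdots\subset\alpha^k$ be the result of Tesler's rightward shift game, and for $0\leq i\leq k$ let $a_i:=\#\{j<i:\alpha^j=\alpha^{j+1}\}$. Then for each $i=0,\dots,k$, $\gamma^i=(b+a_i,\alpha^i_1,\dots,\alpha^i_n,\bar\infty)$. In particular, $r(P)$ is the first row of $T$ and $\mathcal{S}(P)$ consists of the remaining rows of $T$.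
   Context: Stable shapes: finite weakly decreasing sequences of integers and symbols $\infty,\bar\infty$ with $\bar\infty<n<\infty$, ordered componentwise. Stable horizontal strip: $\alpha\subseteq\beta$ such that with $\alpha_m$ the first finite part of $\alpha$ and $\beta_n$ the last finite part of $\beta$, $\alpha_{m-1}=\infty=\beta_m>\alpha_m\geq\beta_{m+1}\geq\cdots\geq\alpha_{n-1}\geq\beta_n>\alpha_n=\bar\infty=\beta_{n+1}$. Ordinary horizontal strip: $\beta_i\geq\alpha_i\geq\beta_{i+1}$. Tableaux (resp. stable tableaux) are chains of shapes with ordinary (resp. stable) horizontal strip differences. Stable complement $T^S:\beta^k\subseteq(\infty,\beta^{k-1})\subseteq\cdots\subseteq(\infty^k,\beta^0)$ of $T:\beta^0\subseteq\cdots\subseteq\beta^k$. Internal column insertion $\mathcal{C}$: operation on pairs of tableaux sharing an inner (resp. outer) border, computed by writing them along the first row and column (resp. last row and column) of a growth diagram and filling in with the local rule $\delta=\mathcal{C}(\alpha;\beta,\gamma)$: $d_m=0$; for $i=m,\dots,2$: $\delta_i=\min\{\beta_i+\gamma_i+d_i-\alpha_i,\alpha_{i-1}\}$, $d_{i-1}=\max\{\beta_i+\gamma_i+d_i-\alpha_i-\alpha_{i-1},0\}$; $\delta_1=\beta_1+\gamma_1+d_1-\alpha_1$ (resp. its unique inverse), returning the opposite row and column. Hopscotch: for a tableau $P$ and stable tableau $Q$, one extending the other, $\mathcal{H}(P;Q):=(T;U^S)$ where $\mathcal{C}(P,Q^S)=(T,U)$. Tesler's rightward shift game: for an almost standard tableau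 $P:\beta^0\subseteq\cdots\subseteq\beta^k$ (each inclusion a single-box cover or an equality), $\mathcal{S}(P):\alpha^0\subseteq\cdots\subseteq\alpha^k$ with each $\beta^i/\alpha^i$ a horizontal strip is built by $\alpha^0:=\beta^0$ and, given $\alpha^{i-1}$: (1) if $\beta^i=\beta^{i-1}$, $\alpha^i:=\alpha^{i-1}$; (2) if $\beta^i/\beta^{i-1}$ is a box in row $r$ and $\beta^{i-1}/\alpha^{i-1}$ has no boxes in rows less than $r$, $\alpha^i:=\alpha^{i-1}$; (3) if $\beta^i/\beta^{i-1}$ is a box in row $r$ and $\beta^{i-1}/\alpha^{i-1}$ has boxes in rows less than $r$, let $r'$ be the largest such row and let $\alpha^i/\alpha^{i-1}$ be a box in row $r'$. $r(P)$ is the set of indices $i$ with $\beta^{i-1}\subsetneq\beta^i$ but $\alpha^{i-1}=\alpha^i$. Rows of $T$: the first row of $T$ is the set of entries $i$ whose box $\gamma^i/\gamma^{i-1}$ lies in the first (initial) row. -}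

module Defs where

open import Data.Nat as ℕ using (ℕ; zero; suc; _<_; _≤_; _<?_)
open import Data.Integer as ℤ using (ℤ; +_)
open import Data.Fin using (Fin; zero; suc; toℕ)
open import Data.Vec as Vec using (Vec; []; _∷_; toList; _[_]%=_)
open import Data.List as List using (List; []; _∷_; _++_; map; reverse; replicate; length; upTo; zipWith; filter)
open import Data.Maybe using (Maybe; just; nothing)
open import Data.Product using (_×_; _,_; proj₁; proj₂; ∃)
open import Relation.Nullary using (yes; no; ¬_)
open import Relation.Binary.PropositionalEquality using (_≡_; _≢_)
open import Data.Unit using (⊤)
import Data.Vec.Properties as VecP

data Ext : Set where
  -∞  : Ext           -- the symbol ∞̄
  fin : ℤ → Ext
  +∞  : Ext

-- stable shapes: finite weakly decreasing sequences of Ext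
-- (trailing ∞̄'s are implicit: shorter shapes are padded by ∞̄ on the right)
StableShape : Set
StableShape = List Ext

minE : Ext → Ext → Ext
minE -∞ _ = -∞
minE _ -∞ = -∞
minE +∞ y = y
minE x +∞ = x
minE (fin x) (fin y) = fin (x ℤ.⊓ y)

-- s = β_i + γ_i + d - α_i   (arguments: α_i β_i γ_i d)
-- Only the all-finite, all-∞ and all-∞̄ cases are meaningful; other
-- combinations get a fixed convention (they never occur in lemma6p7).
sumE : Ext → Ext → Ext → ℤ → Ext
sumE (fin a) (fin b) (fin c) d = fin (b ℤ.+ c ℤ.+ d ℤ.- a)
sumE -∞ -∞ -∞ d = -∞
sumE -∞ _ _ d = +∞
sumE _ -∞ _ d = -∞
sumE _ _ -∞ d = -∞
sumE _ _ _ d = +∞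

carryE : Ext → Ext → ℤ
carryE (fin s) (fin a) = (s ℤ.- a) ℤ.⊔ + 0
carryE _ _ = + 0

-- go αprev α β γ : processes positions from the last to the first.
-- Returns the δ-entries at these positions and the carry d passed to
-- the position before them (d_m = 0 for the last position).
go : Ext → List Ext → List Ext → List Ext → List Ext × ℤ
go aprev (a ∷ as) (b ∷ bs) (c ∷ cs) with go a as bs cs
... | (ds , d) = let s = sumE a b c d in (minE s aprev ∷ ds , carryE s aprev)
go _ _ _ _ = ([] , + 0)

padTo : ℕ → StableShape → StableShape
padTo m xs = xs ++ replicate (m ℕ.∸ length xs) -∞

-- local rule  δ = C(α; β, γ).  Position 1 uses α_0 = ∞, so that
-- δ_1 = min{s_1, ∞} = β_1 + γ_1 + d_1 - α_1.
localRule : StableShape → StableShape → StableShape → StableShape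
localRule α β γ =
  let m = length α ℕ.⊔ length β ℕ.⊔ length γ
  in proj₁ (go +∞ (padTo m α) (padTo m β) (padTo m γ))

last : StableShape → List StableShape → StableShape
last x [] = x
last _ (y ∷ ys) = last y ys

-- given the top row (a tableau, list of shapes) and the shape below its
-- first shape, fill the row below with the local rule
rowBelow : List StableShape → StableShape → List StableShape
rowBelow [] l = l ∷ []
rowBelow (a ∷ []) l = l ∷ []
rowBelow (a ∷ b ∷ rest) l = l ∷ rowBelow (b ∷ rest) (localRule a b l)

-- internal column insertion for tableaux sharing an inner border:
-- top written along the first row, left along the first column;
-- returns (opposite row, opposite column)
colIns : List StableShape → List StableShape → List StableShape × List StableShape
colIns top [] = top , []
colIns top (q ∷ []) = top , last q top ∷ []
colIns [] (q ∷ q' ∷ qs) = [] , []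
colIns (t ∷ ts) (q ∷ q' ∷ qs) with colIns (rowBelow (t ∷ ts) q') (q' ∷ qs)
... | (T , U) = T , last t ts ∷ U

-- stable complement  β^k ⊆ (∞,β^{k-1}) ⊆ ⋯ ⊆ (∞^k,β^0)
stableCompl : List StableShape → List StableShape
stableCompl xs = zipWith (λ j s → replicate j +∞ ++ s) (upTo (length xs)) (reverse xs)

-- hopscotch  H(P;Q) = (T; U^S)  where  C(P, Q^S) = (T, U)
hopscotch : List StableShape → List StableShape → List StableShape × List StableShape
hopscotch P Q with colIns P (stableCompl Q)
... | (T , U) = T , stableCompl U

Decreasing : ∀ {n} → Vec ℕ n → Set
Decreasing [] = ⊤
Decreasing (x ∷ []) = ⊤
Decreasing (x ∷ y ∷ ys) = y ≤ x × Decreasing (y ∷ ys)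

IsStandardTableau : (n k : ℕ) → (ℕ → Vec ℕ n) → Set
IsStandardTableau n k β =
  (∀ i → i ≤ k → Decreasing (β i)) ×
  (∀ i → i < k → ∃ λ (r : Fin n) → β (suc i) ≡ (β i [ r ]%= suc))

-- first (largest) part; 0 for the empty partition
firstPart : ∀ {n} → Vec ℕ n → ℕ
firstPart [] = 0
firstPart (x ∷ _) = x

boxRow : ∀ {n} → Vec ℕ n → Vec ℕ n → Maybe (Fin n)
boxRow [] [] = nothing
boxRow (x ∷ xs) (y ∷ ys) with x <? y
... | yes _ = just zero
... | no _ with boxRow xs ys
...   | just r = just (suc r)
...   | nothing = nothing

-- largest row r' < r such that β/α has a box in row r'
lastGapBelow : ∀ {n} → ℕ → Vec ℕ n → Vec ℕ n → Maybe (Fin n)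
lastGapBelow zero _ _ = nothing
lastGapBelow (suc r) [] [] = nothing
lastGapBelow (suc r) (b ∷ bs) (a ∷ as) with lastGapBelow r bs as
... | just j = just (suc j)
... | nothing with a <? b
...   | yes _ = just zero
...   | no _ = nothing

shiftStep : ∀ {n} → Vec ℕ n → Vec ℕ n → Vec ℕ n → Vec ℕ n
shiftStep βprev βnext αprev with boxRow βprev βnext
... | nothing = αprev
... | just r with lastGapBelow (toℕ r) βprev αprev
...   | nothing = αprev
...   | just r' = αprev [ r' ]%= suc

shiftGame : ∀ {n} → (ℕ → Vec ℕ n) → ℕ → Vec ℕ n
shiftGame β zero = β zero
shiftGame β (suc i) = shiftStep (β i) (β (suc i)) (shiftGame β i)

aCount : ∀ {n} → (ℕ → Vec ℕ n) → ℕ → ℕ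
aCount {n} β i =
  length (filter (λ j → VecP.≡-dec ℕ._≟_ (shiftGame β j) (shiftGame β (suc j))) (upTo i))

InRP : ∀ {n} → (ℕ → Vec ℕ n) → ℕ → Set
InRP β i = ∃ λ j → i ≡ suc j ×
  (β j ≢ β i) × (shiftGame β j ≡ shiftGame β i)

finℕ : ℕ → Ext
finℕ m = fin (+ m)

stab : ∀ {n} → Vec ℕ n → StableShape
stab x = +∞ ∷ (map finℕ (toList x) ++ finℕ 0 ∷ [])

withTop : ∀ {n} → ℕ → Vec ℕ n → StableShape
withTop c x = finℕ c ∷ (map finℕ (toList x) ++ -∞ ∷ [])

Ptab : ∀ {n} → ℕ → (ℕ → Vec ℕ n) → List StableShape
Ptab k β = map (λ i → stab (β i)) (upTo (suc k))

Qtab : ∀ {n} → ℕ → (ℕ → Vec ℕ n) → List StableShape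
Qtab k β = withTop (firstPart (β k)) (β 0) ∷ stab (β 0) ∷ []

Ttab : ∀ {n} → ℕ → (ℕ → Vec ℕ n) → List StableShape
Ttab k β = proj₁ (hopscotch (Ptab k β) (Qtab k β))

nth : {A : Set} → List A → ℕ → Maybe A
nth [] _ = nothing
nth (x ∷ _) zero = just x
nth (_ ∷ xs) (suc i) = nth xs i

firstFinite : StableShape → Maybe ℤ
firstFinite [] = nothing
firstFinite (fin x ∷ _) = just x
firstFinite (_ ∷ xs) = firstFinite xs

-- the box γ^i/γ^{i-1} of T lies in the first (initial) row of T
-- (the row of the first finite part)
InFirstRowOfT : StableShape → StableShape → Set
InFirstRowOfT γprev γ = firstFinite γprev ≢ firstFinite γ

InFirstRowT : ∀ {n} → ℕ → (ℕ → Vec ℕ n) → ℕ → Set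
InFirstRowT k β i = ∃ λ j → i ≡ suc j × ∃ λ γprev → ∃ λ γ →
  nth (Ttab k β) j ≡ just γprev × nth (Ttab k β) i ≡ just γ × InFirstRowOfT γprev γ

{-# OPTIONS --safe #-}
-- Along the first row of the growth diagram of H(P; Q), each γ^i is the local rule
-- C(β^(i-1); β^i, γ^(i-1)).  Write γ^(i-1) = (∞, c, x, ∞̄) with x ⊆ p = β^(i-1), and let β^i
-- add a box in row r.  The finite parts of γ sit one row above those of p, so the rule adds
-- the box's unit to x_(r-1) (where x_0 = c) and, when that part already equals its bound
-- p_(r-1), leaves it and carries the unit one row up; x ⊆ p keeps the carry at most 1.  The
-- unit thus settles in the largest row r' < r where x is shorter than p, which is exactly the
-- box added by Tesler's game, or, when there is no such row, in the unbounded part c.  By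
-- induction γ^i = (∞, b + a_i, α^i, ∞̄) with α^i ⊆ β^i, and the first finite part of T grows
-- exactly at the steps where α does not move, that is on r(P).

module Submission where

open import Defs
open import Data.Nat as ℕ using (ℕ; zero; suc; _+_; _∸_; _≤_; _<_; _<?_)
import Data.Nat.Properties as ℕₚ
open import Data.Nat.Solver using (module +-*-Solver)
open import Algebra.Properties.CommutativeSemigroup ℕₚ.+-commutativeSemigroup using (x∙yz≈y∙xz)
open import Data.Integer as ℤ using (+_; _-_; _⊖_; +≤+)
import Data.Integer.Properties as ℤₚ
open import Data.Fin using (Fin; zero; suc; toℕ)
open import Data.Vec using (Vec; []; _∷_; toList; _[_]%=_)
import Data.Vec.Properties as Vec
open import Data.Vec.Relation.Binary.Pointwise.Inductive as Pointwise using (Pointwise; []; _∷_)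
open import Data.List using (List; []; _∷_; _++_; map; replicate; length; applyUpTo; upTo; filter)
import Data.List.Properties as List
open import Data.Maybe using (Maybe; just; nothing)
import Data.Maybe.Properties as Maybe
open import Data.Product using (_×_; _,_; proj₁; proj₂)
open import Data.Empty using (⊥-elim)
open import Function.Bundles using (_⇔_; mk⇔; Equivalence)
open import Relation.Nullary using (¬_; Dec; yes; no)
open import Relation.Binary.PropositionalEquality
  using (_≡_; _≢_; refl; sym; trans; cong; cong₂; subst₂; module ≡-Reasoning)

open ≡-Reasoning

+[m+n]-+n≡+m : ∀ m n → + (m + n) - + n ≡ + m
+[m+n]-+n≡+m m n = begin
  + (m + n) - + n     ≡⟨ ℤₚ.[+m]-[+n]≡m⊖n (m + n) n ⟩
  (m + n) ⊖ n         ≡⟨ ℤₚ.⊖-≥ (ℕₚ.m≤n+m n m) ⟩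
  + (m + n ∸ n)       ≡⟨ cong +_ (ℕₚ.m+n∸n≡m m n) ⟩
  + m                 ∎

-- u is the growth β_i − α_i of the row and d the incoming carry; putting them in front
-- makes u + d + c compute when they are numerals.
sumE-finℕ : ∀ a u c d → sumE (finℕ a) (finℕ (u + a)) (finℕ c) (+ d) ≡ finℕ (u + d + c)
sumE-finℕ a u c d = cong fin (begin
  + (u + a + c + d) - + a ≡⟨ cong (λ m → + m - + a) (rearrange u a c d) ⟩
  + (u + d + c + a) - + a ≡⟨ +[m+n]-+n≡+m (u + d + c) a ⟩
  + (u + d + c)           ∎)
  where
  open +-*-Solver
  rearrange : ∀ u a c d → u + a + c + d ≡ u + d + c + a
  rearrange = solve 4 (λ u a c d → u :+ a :+ c :+ d := u :+ d :+ c :+ a) refl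

minE-carryE-≤ : ∀ {v t} → v ≤ t →
  (minE (finℕ v) (finℕ t) , carryE (finℕ v) (finℕ t)) ≡ (finℕ v , + 0)
minE-carryE-≤ v≤t = cong₂ _,_
  (cong (λ m → fin (+ m)) (ℕₚ.m≤n⇒m⊓n≡m v≤t))
  (ℤₚ.i≤j⇒i⊔j≡j (ℤₚ.i≤j⇒i-j≤0 (+≤+ v≤t)))

minE-carryE-suc : ∀ t →
  (minE (finℕ (suc t)) (finℕ t) , carryE (finℕ (suc t)) (finℕ t)) ≡ (finℕ t , + 1)
minE-carryE-suc t = cong₂ _,_
  (cong (λ m → fin (+ m)) (ℕₚ.m≥n⇒m⊓n≡n (ℕₚ.n≤1+n t)))
  (cong (ℤ._⊔ + 0) (+[m+n]-+n≡+m 1 t))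

go-∷-finℕ : ∀ {aprev : Ext} {a c d : ℕ} {as bs cs ds : List Ext} u →
  go (finℕ a) as bs cs ≡ (ds , + d) →
  go aprev (finℕ a ∷ as) (finℕ (u + a) ∷ bs) (finℕ c ∷ cs)
    ≡ (minE (finℕ (u + d + c)) aprev ∷ ds , carryE (finℕ (u + d + c)) aprev)
go-∷-finℕ {a = a} {c} {d = d} u below rewrite below | sumE-finℕ a u c d = refl

module _ {a c d : ℕ} {as bs cs ds : List Ext}
         (u : ℕ) (below : go (finℕ a) as bs cs ≡ (ds , + d)) where

  go-absorb : ∀ {t} → u + d + c ≤ t →
    go (finℕ t) (finℕ a ∷ as) (finℕ (u + a) ∷ bs) (finℕ c ∷ cs) ≡ (finℕ (u + d + c) ∷ ds , + 0)
  go-absorb {t} fits = trans (go-∷-finℕ {aprev = finℕ t} {c = c} u below)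
                             (cong (λ (m , carry) → (m ∷ ds , carry)) (minE-carryE-≤ fits))

  go-overflow : ∀ {t} → u + d ≡ 1 → c ≤ t → ¬ c < t →
    go (finℕ t) (finℕ a ∷ as) (finℕ (u + a) ∷ bs) (finℕ c ∷ cs) ≡ (finℕ c ∷ ds , + 1)
  go-overflow u+d≡1 c≤t c≮t with ℕₚ.≤-antisym c≤t (ℕₚ.≮⇒≥ c≮t)
  ... | refl = begin
    go (finℕ c) (finℕ a ∷ as) (finℕ (u + a) ∷ bs) (finℕ c ∷ cs)
      ≡⟨ go-∷-finℕ {aprev = finℕ c} {c = c} u below ⟩
    (minE (finℕ (u + d + c)) (finℕ c) ∷ ds , carryE (finℕ (u + d + c)) (finℕ c))
      ≡⟨ cong (λ v → (minE (finℕ v) (finℕ c) ∷ ds , carryE (finℕ v) (finℕ c)))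
              (cong (_+ c) u+d≡1) ⟩
    (minE (finℕ (suc c)) (finℕ c) ∷ ds , carryE (finℕ (suc c)) (finℕ c))
      ≡⟨ cong (λ (m , carry) → (m ∷ ds , carry)) (minE-carryE-suc c) ⟩
    (finℕ c ∷ ds , + 1) ∎

  go-top : proj₁ (go +∞ (finℕ a ∷ as) (finℕ (u + a) ∷ bs) (finℕ c ∷ cs)) ≡ finℕ (u + d + c) ∷ ds
  go-top = cong proj₁ (go-∷-finℕ {aprev = +∞} {c = c} u below)

paddedParts : ∀ {n} → Vec ℕ n → List Ext
paddedParts p = map finℕ (toList p) ++ finℕ 0 ∷ -∞ ∷ []

finiteShape : ∀ {m} → Vec ℕ m → StableShape
finiteShape v = map finℕ (toList v) ++ -∞ ∷ []

bumpAt : ∀ {n} → Maybe (Fin n) → Vec ℕ n → Vec ℕ n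
bumpAt (just r) x = x [ r ]%= suc
bumpAt nothing  x = x

overflow : ∀ {A : Set} → Maybe A → ℕ
overflow (just _) = 0
overflow nothing  = 1

go-noBox : ∀ {n} {p x : Vec ℕ n} → Pointwise _≤_ x p → ∀ {a y} → y ≤ a →
  go (finℕ a) (paddedParts p) (paddedParts p) (withTop y x) ≡ (withTop y x , + 0)
go-noBox []            = go-absorb {a = 0} {as = -∞ ∷ []} {bs = -∞ ∷ []} {cs = -∞ ∷ []} 0 refl
go-noBox (x≤q ∷ xs≤ps) = go-absorb 0 (go-noBox xs≤ps x≤q)

go-box : ∀ {n} {p x : Vec ℕ n} → Pointwise _≤_ x p → (r : Fin n) → ∀ {a y} → y ≤ a →
  let g = lastGapBelow (suc (toℕ r)) (a ∷ p) (y ∷ x) in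
  go (finℕ a) (paddedParts p) (paddedParts (p [ r ]%= suc)) (withTop y x)
    ≡ (finiteShape (bumpAt g (y ∷ x)) , + overflow g)
go-box (x≤q ∷ xs≤ps) zero {a} {y} y≤a with y <? a
... | yes y<a = go-absorb 1 (go-noBox xs≤ps x≤q) y<a
... | no  y≮a = go-overflow 1 (go-noBox xs≤ps x≤q) refl y≤a y≮a
go-box {p = q ∷ ps} {x ∷ xs} (x≤q ∷ xs≤ps) (suc r) {a} {y} y≤a
  with lastGapBelow (suc (toℕ r)) (q ∷ ps) (x ∷ xs) | go-box xs≤ps r x≤q
... | just _  | below = go-absorb 0 below y≤a
... | nothing | below with y <? a
...   | yes y<a = go-absorb 0 below y<a
...   | no  y≮a = go-overflow 0 below refl y≤a y≮a

go-top-box : ∀ {n} {p x : Vec ℕ n} → Pointwise _≤_ x p → (r : Fin n) (c : ℕ) →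
  let g = lastGapBelow (toℕ r) p x in
  proj₁ (go +∞ (paddedParts p) (paddedParts (p [ r ]%= suc)) (withTop c x))
    ≡ withTop (overflow g + c) (bumpAt g x)
go-top-box (x≤q ∷ xs≤ps) zero    c = go-top 1 (go-noBox xs≤ps x≤q)
go-top-box (x≤q ∷ xs≤ps) (suc r) c = go-top 0 (go-box xs≤ps r x≤q)

length-parts : ∀ {n} (x : Vec ℕ n) e → length (map finℕ (toList x) ++ e ∷ []) ≡ suc n
length-parts {n} x e = begin
  length (map finℕ (toList x) ++ e ∷ [])  ≡⟨ List.length-++ (map finℕ (toList x)) ⟩
  length (map finℕ (toList x)) + 1        ≡⟨ cong (_+ 1) (List.length-map finℕ (toList x)) ⟩
  length (toList x) + 1                   ≡⟨ cong (_+ 1) (Vec.length-toList x) ⟩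
  n + 1                                   ≡⟨ ℕₚ.+-comm n 1 ⟩
  suc n                                   ∎

padTo-exact : ∀ {m} xs j → length xs + j ≡ m → padTo m xs ≡ xs ++ replicate j -∞
padTo-exact xs j refl = cong (λ i → xs ++ replicate i -∞) (ℕₚ.m+n∸m≡n (length xs) j)

padTo-stab : ∀ {n} (p : Vec ℕ n) → padTo (3 + n) (stab p) ≡ +∞ ∷ paddedParts p
padTo-stab {n} p = begin
  padTo (3 + n) (stab p)  ≡⟨ padTo-exact (stab p) 1 width ⟩
  stab p ++ -∞ ∷ []
    ≡⟨ cong (+∞ ∷_) (List.++-assoc (map finℕ (toList p)) (finℕ 0 ∷ []) (-∞ ∷ [])) ⟩
  +∞ ∷ paddedParts p      ∎
  where
  width : length (stab p) + 1 ≡ 3 + n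
  width = trans (cong (λ l → suc l + 1) (length-parts p (finℕ 0))) (ℕₚ.+-comm (2 + n) 1)

padTo-withTop : ∀ {n} c (x : Vec ℕ n) → padTo (3 + n) (+∞ ∷ withTop c x) ≡ +∞ ∷ withTop c x
padTo-withTop {n} c x =
  trans (padTo-exact (+∞ ∷ withTop c x) 0 width) (List.++-identityʳ (+∞ ∷ withTop c x))
  where
  width : length (+∞ ∷ withTop c x) + 0 ≡ 3 + n
  width = trans (cong (λ l → suc (suc l) + 0) (length-parts x -∞)) (ℕₚ.+-identityʳ (3 + n))

localRule-width : ∀ {n} (p p′ x : Vec ℕ n) c →
  length (stab p) ℕ.⊔ length (stab p′) ℕ.⊔ length (+∞ ∷ withTop c x) ≡ 3 + n
localRule-width {n} p p′ x c
  rewrite length-parts p (finℕ 0) | length-parts p′ (finℕ 0) | length-parts x -∞ | ℕₚ.⊔-idem n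
  = cong (λ m → 2 + m) (ℕₚ.m≤n⇒m⊔n≡n (ℕₚ.n≤1+n n))

localRule-stab : ∀ {n} (p p′ x : Vec ℕ n) c →
  localRule (stab p) (stab p′) (+∞ ∷ withTop c x)
    ≡ +∞ ∷ proj₁ (go +∞ (paddedParts p) (paddedParts p′) (withTop c x))
localRule-stab {n} p p′ x c = begin
  localRule (stab p) (stab p′) (+∞ ∷ withTop c x)  ≡⟨ cong column (localRule-width p p′ x c) ⟩
  column (3 + n)
    ≡⟨ cong₂ (λ α β → proj₁ (go +∞ α β (padTo (3 + n) (+∞ ∷ withTop c x))))
             (padTo-stab p) (padTo-stab p′) ⟩
  proj₁ (go +∞ (+∞ ∷ paddedParts p) (+∞ ∷ paddedParts p′) (padTo (3 + n) (+∞ ∷ withTop c x)))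
    ≡⟨ cong (λ γ → proj₁ (go +∞ (+∞ ∷ paddedParts p) (+∞ ∷ paddedParts p′) γ))
            (padTo-withTop c x) ⟩
  +∞ ∷ proj₁ (go +∞ (paddedParts p) (paddedParts p′) (withTop c x)) ∎
  where
  column : ℕ → StableShape
  column m = proj₁ (go +∞ (padTo m (stab p)) (padTo m (stab p′)) (padTo m (+∞ ∷ withTop c x)))

localRule-addBox : ∀ {n} {p x : Vec ℕ n} → Pointwise _≤_ x p → (r : Fin n) (c : ℕ) →
  let g = lastGapBelow (toℕ r) p x in
  localRule (stab p) (stab (p [ r ]%= suc)) (+∞ ∷ withTop c x)
    ≡ +∞ ∷ withTop (overflow g + c) (bumpAt g x)
localRule-addBox {p = p} {x} x≤p r c =
  trans (localRule-stab p (p [ r ]%= suc) x c) (cong (+∞ ∷_) (go-top-box x≤p r c))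

addBox-≢ : ∀ {n} (x : Vec ℕ n) r → x ≢ x [ r ]%= suc
addBox-≢ (a ∷ _)  zero    eq = ℕₚ.1+n≢n (sym (Vec.∷-injectiveˡ eq))
addBox-≢ (_ ∷ xs) (suc r) eq = addBox-≢ xs r (Vec.∷-injectiveʳ eq)

≤-addBox : ∀ {n} {x p : Vec ℕ n} r → Pointwise _≤_ x p → Pointwise _≤_ x (p [ r ]%= suc)
≤-addBox zero    (a≤b ∷ as≤bs) = ℕₚ.m≤n⇒m≤1+n a≤b ∷ as≤bs
≤-addBox (suc r) (a≤b ∷ as≤bs) = a≤b ∷ ≤-addBox r as≤bs

bumpAt-lastGapBelow-≤ : ∀ m {n} {p x : Vec ℕ n} → Pointwise _≤_ x p →
  Pointwise _≤_ (bumpAt (lastGapBelow m p x) x) p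
bumpAt-lastGapBelow-≤ zero    x≤p = x≤p
bumpAt-lastGapBelow-≤ (suc m) []  = []
bumpAt-lastGapBelow-≤ (suc m) {p = b ∷ bs} {a ∷ as} (a≤b ∷ as≤bs)
  with lastGapBelow m bs as | bumpAt-lastGapBelow-≤ m as≤bs
... | just _  | bumped≤bs = a≤b ∷ bumped≤bs
... | nothing | _ with a <? b
...   | yes a<b = a<b ∷ as≤bs
...   | no  _   = a≤b ∷ as≤bs

boxRow-addBox : ∀ {n} (p : Vec ℕ n) r → boxRow p (p [ r ]%= suc) ≡ just r
boxRow-addBox (q ∷ _) zero with q <? suc q
... | yes _    = refl
... | no  q≮1+q = ⊥-elim (q≮1+q (ℕₚ.n<1+n q))
boxRow-addBox (q ∷ ps) (suc r) with q <? q
... | yes q<q = ⊥-elim (ℕₚ.<-irrefl refl q<q)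
... | no  _ rewrite boxRow-addBox ps r = refl

shiftStep-addBox : ∀ {n} (p x : Vec ℕ n) r →
  shiftStep p (p [ r ]%= suc) x ≡ bumpAt (lastGapBelow (toℕ r) p x) x
shiftStep-addBox p x r rewrite boxRow-addBox p r with lastGapBelow (toℕ r) p x
... | just _  = refl
... | nothing = refl

module _ {n} (β : ℕ → Vec ℕ n) where

  private
    stays? : ∀ j → Dec (shiftGame β j ≡ shiftGame β (suc j))
    stays? j = Vec.≡-dec ℕ._≟_ (shiftGame β j) (shiftGame β (suc j))

  aCount-suc : ∀ i → aCount β (suc i) ≡ aCount β i + length (filter stays? (i ∷ []))
  aCount-suc i = begin
    length (filter stays? (upTo (suc i)))
      ≡⟨ cong (λ l → length (filter stays? l)) (sym (List.upTo-∷ʳ i)) ⟩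
    length (filter stays? (upTo i ++ i ∷ []))
      ≡⟨ cong length (List.filter-++ stays? (upTo i) (i ∷ [])) ⟩
    length (filter stays? (upTo i) ++ filter stays? (i ∷ []))
      ≡⟨ List.length-++ (filter stays? (upTo i)) ⟩
    aCount β i + length (filter stays? (i ∷ [])) ∎

  aCount-suc-≡ : ∀ i → shiftGame β i ≡ shiftGame β (suc i) →
    aCount β (suc i) ≡ suc (aCount β i)
  aCount-suc-≡ i stays = begin
    aCount β (suc i)                              ≡⟨ aCount-suc i ⟩
    aCount β i + length (filter stays? (i ∷ []))
      ≡⟨ cong (λ l → aCount β i + length l) (List.filter-accept stays? stays) ⟩
    aCount β i + 1                                ≡⟨ ℕₚ.+-comm (aCount β i) 1 ⟩
    suc (aCount β i)                              ∎

  aCount-suc-≢ : ∀ i → shiftGame β i ≢ shiftGame β (suc i) → aCount β (suc i) ≡ aCount β i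
  aCount-suc-≢ i moves = begin
    aCount β (suc i)                              ≡⟨ aCount-suc i ⟩
    aCount β i + length (filter stays? (i ∷ []))
      ≡⟨ cong (λ l → aCount β i + length l) (List.filter-reject stays? moves) ⟩
    aCount β i + 0                                ≡⟨ ℕₚ.+-identityʳ (aCount β i) ⟩
    aCount β i                                    ∎

  aCount-suc-bumpAt : ∀ i (g : Maybe (Fin n)) → shiftGame β (suc i) ≡ bumpAt g (shiftGame β i) →
    aCount β (suc i) ≡ overflow g + aCount β i
  aCount-suc-bumpAt i (just r) step = aCount-suc-≢ i (λ stays → addBox-≢ _ r (trans stays step))
  aCount-suc-bumpAt i nothing  step = aCount-suc-≡ i (sym step)

growthRow : (ℕ → StableShape) → StableShape → ℕ → StableShape
growthRow h γ zero    = γ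
growthRow h γ (suc i) = localRule (h i) (h (suc i)) (growthRow h γ i)

growthRow-shift : ∀ h γ i →
  growthRow h γ (suc i) ≡ growthRow (λ j → h (suc j)) (localRule (h 0) (h 1) γ) i
growthRow-shift h γ zero    = refl
growthRow-shift h γ (suc i) = cong (localRule (h (suc i)) (h (2 + i))) (growthRow-shift h γ i)

nth-rowBelow : ∀ h k γ i → i ≤ k →
  nth (rowBelow (applyUpTo h (suc k)) γ) i ≡ just (growthRow h γ i)
nth-rowBelow h zero    γ zero    _         = refl
nth-rowBelow h (suc k) γ zero    _         = refl
nth-rowBelow h (suc k) γ (suc i) (ℕ.s≤s i≤k) =
  trans (nth-rowBelow (λ j → h (suc j)) k (localRule (h 0) (h 1) γ) i i≤k)
        (cong just (sym (growthRow-shift h γ i)))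

module _ {n k : ℕ} {β : ℕ → Vec ℕ n} (standard : IsStandardTableau n k β) where

  private
    b : ℕ
    b = firstPart (β k)

    P : ℕ → StableShape
    P i = stab (β i)

    γ⁰ : StableShape
    γ⁰ = +∞ ∷ withTop b (β 0)

  γ : ℕ → StableShape
  γ i = +∞ ∷ withTop (b + aCount β i) (shiftGame β i)

  growthRow-γ : ∀ i → i ≤ k → growthRow P γ⁰ i ≡ γ i × Pointwise _≤_ (shiftGame β i) (β i)
  growthRow-γ zero _ =
    cong (λ c → +∞ ∷ withTop c (β 0)) (sym (ℕₚ.+-identityʳ b)) , Pointwise.refl ℕₚ.≤-refl
  growthRow-γ (suc i) i<k with proj₂ standard i i<k | growthRow-γ i (ℕₚ.<⇒≤ i<k)
  ... | r , β-step | γ-eq , α≤β =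
    γ-step , subst₂ (Pointwise _≤_) (sym α-step) (sym β-step) α≤β′
    where
    α : Vec ℕ n
    α = shiftGame β i
    g : Maybe (Fin n)
    g = lastGapBelow (toℕ r) (β i) α

    α-step : shiftGame β (suc i) ≡ bumpAt g α
    α-step = trans (cong (λ v → shiftStep (β i) v α) β-step) (shiftStep-addBox (β i) α r)

    α≤β′ : Pointwise _≤_ (bumpAt g α) (β i [ r ]%= suc)
    α≤β′ = ≤-addBox r (bumpAt-lastGapBelow-≤ (toℕ r) α≤β)

    first-part : overflow g + (b + aCount β i) ≡ b + aCount β (suc i)
    first-part = begin
      overflow g + (b + aCount β i) ≡⟨ x∙yz≈y∙xz (overflow g) b (aCount β i) ⟩
      b + (overflow g + aCount β i) ≡⟨ cong (λ m → b + m) (sym (aCount-suc-bumpAt β i g α-step)) ⟩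
      b + aCount β (suc i) ∎

    γ-step : growthRow P γ⁰ (suc i) ≡ γ (suc i)
    γ-step = begin
      localRule (P i) (P (suc i)) (growthRow P γ⁰ i)
        ≡⟨ cong₂ (λ v T → localRule (P i) (stab v) T) β-step γ-eq ⟩
      localRule (P i) (stab (β i [ r ]%= suc)) (γ i)
        ≡⟨ localRule-addBox α≤β r (b + aCount β i) ⟩
      +∞ ∷ withTop (overflow g + (b + aCount β i)) (bumpAt g α)
        ≡⟨ cong₂ (λ c v → +∞ ∷ withTop c v) first-part (sym α-step) ⟩
      γ (suc i) ∎

  -- Q^S is the single step β^0 ⊆ (∞, γ^0), so T is the row of the growth diagram below P
  -- that starts at (∞, γ^0).
  nth-Ttab : ∀ i → i ≤ k → nth (Ttab k β) i ≡ just (γ i)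
  nth-Ttab i i≤k = begin
    nth (rowBelow (map P (upTo (suc k))) γ⁰) i
      ≡⟨ cong (λ row → nth (rowBelow row γ⁰) i) (List.map-upTo P (suc k)) ⟩
    nth (rowBelow (applyUpTo P (suc k)) γ⁰) i
      ≡⟨ nth-rowBelow P k γ⁰ i i≤k ⟩
    just (growthRow P γ⁰ i)
      ≡⟨ cong just (proj₁ (growthRow-γ i i≤k)) ⟩
    just (γ i) ∎

  firstRow-γ⇔stays : ∀ j →
    InFirstRowOfT (γ j) (γ (suc j)) ⇔ (shiftGame β j ≡ shiftGame β (suc j))
  firstRow-γ⇔stays j = mk⇔ to from
    where
    to : InFirstRowOfT (γ j) (γ (suc j)) → shiftGame β j ≡ shiftGame β (suc j)
    to grows with Vec.≡-dec ℕ._≟_ (shiftGame β j) (shiftGame β (suc j))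
    ... | yes stays = stays
    ... | no  moves =
      ⊥-elim (grows (cong (λ a → just (+ (b + a))) (sym (aCount-suc-≢ β j moves))))
    from : shiftGame β j ≡ shiftGame β (suc j) → InFirstRowOfT (γ j) (γ (suc j))
    from stays same = ℕₚ.1+n≢n (sym (trans
      (ℕₚ.+-cancelˡ-≡ b _ _ (ℤₚ.+-injective (Maybe.just-injective same)))
      (aCount-suc-≡ β j stays)))

  InRP⇔InFirstRowT : ∀ i → i ≤ k → InRP β i ⇔ InFirstRowT k β i
  InRP⇔InFirstRowT i i≤k = mk⇔ to from
    where
    to : InRP β i → InFirstRowT k β i
    to (j , refl , _ , stays) =
      j , refl , γ j , γ (suc j) , nth-Ttab j (ℕₚ.<⇒≤ i≤k) , nth-Ttab (suc j) i≤k ,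
      Equivalence.from (firstRow-γ⇔stays j) stays
    from : InFirstRowT k β i → InRP β i
    from (j , refl , γʲ , γʲ⁺¹ , Tʲ , Tʲ⁺¹ , grows) =
      j , refl , β-moves ,
      Equivalence.to (firstRow-γ⇔stays j) (subst₂ InFirstRowOfT γʲ≡ γʲ⁺¹≡ grows)
      where
      γʲ≡ : γʲ ≡ γ j
      γʲ≡ = Maybe.just-injective (trans (sym Tʲ) (nth-Ttab j (ℕₚ.<⇒≤ i≤k)))
      γʲ⁺¹≡ : γʲ⁺¹ ≡ γ (suc j)
      γʲ⁺¹≡ = Maybe.just-injective (trans (sym Tʲ⁺¹) (nth-Ttab (suc j) i≤k))
      β-moves : β j ≢ β (suc j)
      β-moves with proj₂ standard j i≤k
      ... | r , β-step = λ same → addBox-≢ (β j) r (trans same β-step)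

lemma6p7 : (n k : ℕ) (β : ℕ → Vec ℕ n) → IsStandardTableau n k β →
    ((i : ℕ) → i ≤ k →
      nth (Ttab k β) i ≡ just (+∞ ∷ withTop (firstPart (β k) + aCount β i) (shiftGame β i)))
    × ((i : ℕ) → i ≤ k → (InRP β i ⇔ InFirstRowT k β i))
lemma6p7 n k β standard = nth-Ttab standard , InRP⇔InFirstRowT standard
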